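{- Let $R$ be univalent and injective. Then the following eight properties are equivalent: (1) $R\mathbin{;}\mathsf{L}\mathbin{;}R\subseteq R^*\cup R^{\top*}$; (2) $R\mathbin{;}\mathsf{L}\mathbin{;}R^{\top}\subseteq R^*\cup R^{\top*}$; (3) $R^{\top}\mathbin{;}\mathsf{L}\mathbin{;}R\subseteq R^*\cup R^{\top*}$; (4) $R^{\top}\mathbin{;}\mathsf{L}\mathbin{;}R^{\top}\subseteq R^*\cup R^{\top*}$; (5) $R^+\mathbin{;}\mathsf{L}\mathbin{;}R^+\subseteq R^*\cup R^{\top*}$; (6) $R^+\mathbin{;}\mathsf{L}\mathbin{;}R^{\top+}\subseteq R^*\cup R^{\top*}$; (7) $R^{\top+}\mathbin{;}\mathsf{L}\mathbin{;}R^+\subseteq R^*\cup R^{\top*}$; (8) $R^{\top+}\mathbin{;}\mathsf{L}\mathbin{;}R^{\top+}\subseteq R^*\cup R^{\top*}$.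
   Context: $(B,\cup,\mathbin{;},\overline{\,\cdot\,},{}^{\top},{}^{*},\mathsf{I})$ is a Kleene relation algebra; all variables range over $B$. That is, $(B,\cup,\mathbin{;},\overline{\,\cdot\,},{}^{\top},\mathsf{I})$ is a relation algebra: $\cup$ is associative and commutative and $R=\overline{\overline{R}\cup\overline{S}}\cup\overline{\overline{R}\cup S}$; $\mathbin{;}$ is associative, $(R\cup S)\mathbin{;}T=R\mathbin{;}T\cup S\mathbin{;}T$, $R\mathbin{;}\mathsf{I}=R$; $(R^{\top})^{\top}=R$, $(R\cup S)^{\top}=R^{\top}\cup S^{\top}$, $(R\mathbin{;}S)^{\top}=S^{\top}\mathbin{;}R^{\top}$; $R^{\top}\mathbin{;}\overline{R\mathbin{;}S}\cup\overline{S}=\overline{S}$. The order is $R\subseteq S$ iff $R\cup S=S$; $R\cap S=\overline{\overline{R}\cup\overline{S}}$; $\mathsf{L}=R\cup\overline{R}$ is the greatest and $\mathsf{O}=R\cap\overline{R}$ the least element. The star satisfies $\mathsf{I}\cup R\mathbin{;}R^*\subseteq R^*$, $\mathsf{I}\cup R^*\mathbin{;}R\subseteq R^*$, $S\cup R\mathbin{;}Q\subseteq Q\Rightarrow R^*\mathbin{;}S\subseteq Q$, $S\cup Q\mathbin{;}R\subseteq Q\Rightarrow S\mathbin{;}R^*\subseteq Q$. Write $R^+=R\mathbin{;}R^*$, $R^{\top*}=(R^{\top})^*$, $R^{\top+}=(R^{\top})^+$. The algebra satisfies the Tarski rule ($R\neq\mathsf{O}$ iff $\mathsf{L}\mathbin{;}R\mathbin{;}\mathsf{L}=\mathsf{L}$)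 and the point axiom (for every $R\neq\mathsf{O}$ there are points $p,q$ with $p\mathbin{;}q^{\top}\subseteq R$), where a point is an element $p$ with $p=p\mathbin{;}\mathsf{L}$, $p\mathbin{;}p^{\top}\subseteq\mathsf{I}$ and $\mathsf{I}\subseteq p^{\top}\mathbin{;}p$. Composition binds tighter than $\cup,\cap$; complement and converse bind tighter than composition. $R$ is univalent if $R^{\top}\mathbin{;}R\subseteq\mathsf{I}$ and injective if $R\mathbin{;}R^{\top}\subseteq\mathsf{I}$. -}

module Defs where

open import Level using (Level) renaming (suc to lsuc)
open import Relation.Binary.PropositionalEquality using (_≡_)
open import Relation.Nullary using (¬_)
open import Data.Product using (Σ; _×_)
open import Data.Fin using (Fin; zero; suc)


record KleeneRelationAlgebra (c : Level) : Set (lsuc c) where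
  infixl 6 _∪_
  infixl 7 _⨾_
  infix 4 _⊆_
  field
    B    : Set c
    _∪_  : B → B → B
    _⨾_  : B → B → B
    ∁    : B → B
    _ᵀ   : B → B
    _*   : B → B
    I    : B

  _⊆_ : B → B → Set c
  R ⊆ S = R ∪ S ≡ S

  _∩_ : B → B → B
  R ∩ S = ∁ (∁ R ∪ ∁ S)

  field
    ∪-assoc  : ∀ R S T → (R ∪ S) ∪ T ≡ R ∪ (S ∪ T)
    ∪-comm   : ∀ R S → R ∪ S ≡ S ∪ R
    huntington : ∀ R S → R ≡ ∁ (∁ R ∪ ∁ S) ∪ ∁ (∁ R ∪ S)
    ⨾-assoc  : ∀ R S T → (R ⨾ S) ⨾ T ≡ R ⨾ (S ⨾ T)
    ⨾-distribʳ : ∀ R S T → (R ∪ S) ⨾ T ≡ R ⨾ T ∪ S ⨾ T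
    ⨾-identityʳ : ∀ R → R ⨾ I ≡ R
    ᵀ-involutive : ∀ R → (R ᵀ) ᵀ ≡ R
    ᵀ-∪ : ∀ R S → (R ∪ S) ᵀ ≡ R ᵀ ∪ S ᵀ
    ᵀ-⨾ : ∀ R S → (R ⨾ S) ᵀ ≡ S ᵀ ⨾ R ᵀ
    schröder : ∀ R S → (R ᵀ) ⨾ ∁ (R ⨾ S) ∪ ∁ S ≡ ∁ S

  L : B
  L = I ∪ ∁ I

  O : B
  O = I ∩ ∁ I

  field
    star-unfoldˡ : ∀ R → I ∪ R ⨾ (R *) ⊆ R *
    star-unfoldʳ : ∀ R → I ∪ (R *) ⨾ R ⊆ R *
    star-inductˡ : ∀ R S Q → S ∪ R ⨾ Q ⊆ Q → (R *) ⨾ S ⊆ Q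
    star-inductʳ : ∀ R S Q → S ∪ Q ⨾ R ⊆ Q → S ⨾ (R *) ⊆ Q

  IsPoint : B → Set c
  IsPoint p = (p ≡ p ⨾ L) × (p ⨾ (p ᵀ) ⊆ I) × (I ⊆ (p ᵀ) ⨾ p)

  field
    tarski₁ : ∀ R → ¬ (R ≡ O) → L ⨾ R ⨾ L ≡ L
    tarski₂ : ∀ R → L ⨾ R ⨾ L ≡ L → ¬ (R ≡ O)
    point-axiom : ∀ R → ¬ (R ≡ O) →
      Σ B λ p → Σ B λ q → IsPoint p × IsPoint q × (p ⨾ (q ᵀ) ⊆ R)

  _⁺ : B → B
  R ⁺ = R ⨾ (R *)

  Univalent : B → Set c
  Univalent R = (R ᵀ) ⨾ R ⊆ I

  Injective : B → Set c
  Injective R = R ⨾ (R ᵀ) ⊆ I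

  -- The eight properties (1)–(8), indexed 0..7.
  Property : B → Fin 8 → Set c
  Property R i = (lhs i) ⊆ (R *) ∪ ((R ᵀ) *)
    where
    lhs : Fin 8 → B
    lhs zero = R ⨾ L ⨾ R
    lhs (suc zero) = R ⨾ L ⨾ (R ᵀ)
    lhs (suc (suc zero)) = (R ᵀ) ⨾ L ⨾ R
    lhs (suc (suc (suc zero))) = (R ᵀ) ⨾ L ⨾ (R ᵀ)
    lhs (suc (suc (suc (suc zero)))) = (R ⁺) ⨾ L ⨾ (R ⁺)
    lhs (suc (suc (suc (suc (suc zero))))) = (R ⁺) ⨾ L ⨾ ((R ᵀ) ⁺)
    lhs (suc (suc (suc (suc (suc (suc zero)))))) = ((R ᵀ) ⁺) ⨾ L ⨾ (R ⁺)
    lhs (suc (suc (suc (suc (suc (suc (suc zero))))))) = ((R ᵀ) ⁺) ⨾ L ⨾ ((R ᵀ) ⁺)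

-- Univalence and injectivity make C = R * ∪ (R ᵀ) * closed under composition
-- with R and R ᵀ on both sides. Since X ⊆ X ⨾ X ᵀ ⨾ X in any relation algebra,
-- L ⨾ R ⊆ L ⨾ R ᵀ ⨾ R, so X ⨾ L ⨾ R ᵀ ⊆ C gives X ⨾ L ⨾ R ⊆ C ⨾ R ⊆ C, and
-- symmetrically; thus the choice between R and R ᵀ on either side of L does not
-- matter. Finally L ⨾ Y ⨾ Y * ⊆ L ⨾ Y by star induction, so X ⁺ ⨾ L ⨾ Y ⁺ and
-- X ⨾ L ⨾ Y have the same upper bounds, which reduces (5)–(8) to (1)–(4).
module Submission where

open import Defs
open import Level using (Level)
open import Data.Fin using (Fin; zero; suc)
open import Function using (_∘_; id)
open import Relation.Binary.PropositionalEquality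
open import Relation.Binary.Structures using (IsPreorder)
import Relation.Binary.Reasoning.Base.Double as DoubleReasoning
open import Relation.Binary.Reasoning.Syntax using (module ⊆-syntax)

module KleeneRelationAlgebraProperties {c : Level} (K : KleeneRelationAlgebra c) where
  open KleeneRelationAlgebra K

  private variable
    P Q R S T X Y : B

  ᵀ-identity : I ᵀ ≡ I
  ᵀ-identity = sym (begin
    I               ≡⟨ ᵀ-involutive I ⟨
    (I ᵀ) ᵀ         ≡⟨ cong _ᵀ (⨾-identityʳ (I ᵀ)) ⟨
    (I ᵀ ⨾ I) ᵀ     ≡⟨ ᵀ-⨾ (I ᵀ) I ⟩
    I ᵀ ⨾ (I ᵀ) ᵀ   ≡⟨ cong (I ᵀ ⨾_) (ᵀ-involutive I) ⟩
    I ᵀ ⨾ I         ≡⟨ ⨾-identityʳ (I ᵀ) ⟩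
    I ᵀ             ∎)
    where open ≡-Reasoning

  ⨾-identityˡ : ∀ R → I ⨾ R ≡ R
  ⨾-identityˡ R = begin
    I ⨾ R           ≡⟨ ᵀ-involutive (I ⨾ R) ⟨
    ((I ⨾ R) ᵀ) ᵀ   ≡⟨ cong _ᵀ (ᵀ-⨾ I R) ⟩
    (R ᵀ ⨾ I ᵀ) ᵀ   ≡⟨ cong (λ Z → (R ᵀ ⨾ Z) ᵀ) ᵀ-identity ⟩
    (R ᵀ ⨾ I) ᵀ     ≡⟨ cong _ᵀ (⨾-identityʳ (R ᵀ)) ⟩
    (R ᵀ) ᵀ         ≡⟨ ᵀ-involutive R ⟩
    R               ∎
    where open ≡-Reasoning

  ᵀ-⨾-ᵀ : ∀ R S → (R ᵀ ⨾ S ᵀ) ᵀ ≡ S ⨾ R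
  ᵀ-⨾-ᵀ R S = trans (ᵀ-⨾ (R ᵀ) (S ᵀ)) (cong₂ _⨾_ (ᵀ-involutive S) (ᵀ-involutive R))

  ⨾-distribˡ : ∀ T R S → T ⨾ (R ∪ S) ≡ T ⨾ R ∪ T ⨾ S
  ⨾-distribˡ T R S = begin
    T ⨾ (R ∪ S)                       ≡⟨ ᵀ-involutive _ ⟨
    ((T ⨾ (R ∪ S)) ᵀ) ᵀ               ≡⟨ cong _ᵀ (ᵀ-⨾ T (R ∪ S)) ⟩
    ((R ∪ S) ᵀ ⨾ T ᵀ) ᵀ               ≡⟨ cong (λ Z → (Z ⨾ T ᵀ) ᵀ) (ᵀ-∪ R S) ⟩
    ((R ᵀ ∪ S ᵀ) ⨾ T ᵀ) ᵀ             ≡⟨ cong _ᵀ (⨾-distribʳ (R ᵀ) (S ᵀ) (T ᵀ)) ⟩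
    (R ᵀ ⨾ T ᵀ ∪ S ᵀ ⨾ T ᵀ) ᵀ         ≡⟨ ᵀ-∪ _ _ ⟩
    (R ᵀ ⨾ T ᵀ) ᵀ ∪ (S ᵀ ⨾ T ᵀ) ᵀ     ≡⟨ cong₂ _∪_ (ᵀ-⨾-ᵀ R T) (ᵀ-⨾-ᵀ S T) ⟩
    T ⨾ R ∪ T ⨾ S                     ∎
    where open ≡-Reasoning

  ∁-∪-idem : ∀ S → ∁ S ∪ ∁ S ≡ ∁ S
  ∁-∪-idem S = begin
    ∁ S ∪ ∁ S                  ≡⟨ cong (_∪ ∁ S) Iᵀ⨾∁[I⨾S] ⟨
    I ᵀ ⨾ ∁ (I ⨾ S) ∪ ∁ S      ≡⟨ schröder I S ⟩
    ∁ S                        ∎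
    where
    open ≡-Reasoning
    Iᵀ⨾∁[I⨾S] : I ᵀ ⨾ ∁ (I ⨾ S) ≡ ∁ S
    Iᵀ⨾∁[I⨾S] = begin
      I ᵀ ⨾ ∁ (I ⨾ S)   ≡⟨ cong (_⨾ ∁ (I ⨾ S)) ᵀ-identity ⟩
      I ⨾ ∁ (I ⨾ S)     ≡⟨ ⨾-identityˡ _ ⟩
      ∁ (I ⨾ S)         ≡⟨ cong ∁ (⨾-identityˡ S) ⟩
      ∁ S               ∎

  ∪-interchange : ∀ P Q R S → (P ∪ Q) ∪ (R ∪ S) ≡ (P ∪ R) ∪ (Q ∪ S)
  ∪-interchange P Q R S = begin
    (P ∪ Q) ∪ (R ∪ S)   ≡⟨ ∪-assoc P Q (R ∪ S) ⟩
    P ∪ (Q ∪ (R ∪ S))   ≡⟨ cong (P ∪_) (∪-assoc Q R S) ⟨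
    P ∪ ((Q ∪ R) ∪ S)   ≡⟨ cong (λ Z → P ∪ (Z ∪ S)) (∪-comm Q R) ⟩
    P ∪ ((R ∪ Q) ∪ S)   ≡⟨ cong (P ∪_) (∪-assoc R Q S) ⟩
    P ∪ (R ∪ (Q ∪ S))   ≡⟨ ∪-assoc P R (Q ∪ S) ⟨
    (P ∪ R) ∪ (Q ∪ S)   ∎
    where open ≡-Reasoning

  ∪-idem : ∀ R → R ∪ R ≡ R
  ∪-idem R = begin
    R ∪ R               ≡⟨ cong (λ Z → Z ∪ Z) (huntington R R) ⟩
    (M ∪ N) ∪ (M ∪ N)   ≡⟨ ∪-interchange M N M N ⟩
    (M ∪ M) ∪ (N ∪ N)   ≡⟨ cong₂ _∪_ (∁-∪-idem _) (∁-∪-idem _) ⟩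
    M ∪ N               ≡⟨ huntington R R ⟨
    R                   ∎
    where
    open ≡-Reasoning
    M N : B
    M = ∁ (∁ R ∪ ∁ R)
    N = ∁ (∁ R ∪ R)

  ⊆-refl : R ⊆ R
  ⊆-refl = ∪-idem _

  ⊆-reflexive : R ≡ S → R ⊆ S
  ⊆-reflexive refl = ⊆-refl

  ⊆-trans : R ⊆ S → S ⊆ T → R ⊆ T
  ⊆-trans {R} {S} {T} R⊆S S⊆T = begin
    R ∪ T         ≡⟨ cong (R ∪_) S⊆T ⟨
    R ∪ (S ∪ T)   ≡⟨ ∪-assoc R S T ⟨
    (R ∪ S) ∪ T   ≡⟨ cong (_∪ T) R⊆S ⟩
    S ∪ T         ≡⟨ S⊆T ⟩
    T             ∎
    where open ≡-Reasoning

  ⊆-isPreorder : IsPreorder _≡_ _⊆_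
  ⊆-isPreorder = record
    { isEquivalence = isEquivalence
    ; reflexive     = ⊆-reflexive
    ; trans         = ⊆-trans
    }

  module ⊆-Reasoning where
    open DoubleReasoning ⊆-isPreorder public
    open ⊆-syntax _IsRelatedTo_ _IsRelatedTo_ ≲-go public

  R⊆R∪S : R ⊆ R ∪ S
  R⊆R∪S {R} {S} = trans (sym (∪-assoc R R S)) (cong (_∪ S) (∪-idem R))

  S⊆R∪S : S ⊆ R ∪ S
  S⊆R∪S {S} {R} = subst (S ⊆_) (∪-comm S R) R⊆R∪S

  ∪-least : R ⊆ T → S ⊆ T → R ∪ S ⊆ T
  ∪-least {R} {T} {S} R⊆T S⊆T = trans (∪-assoc R S T) (trans (cong (R ∪_) S⊆T) R⊆T)

  ∪-mono : P ⊆ R → Q ⊆ S → P ∪ Q ⊆ R ∪ S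
  ∪-mono P⊆R Q⊆S = ∪-least (⊆-trans P⊆R R⊆R∪S) (⊆-trans Q⊆S S⊆R∪S)

  R∩S⊆R : R ∩ S ⊆ R
  R∩S⊆R {R} {S} = subst (R ∩ S ⊆_) (sym (huntington R S)) R⊆R∪S

  R∩S⊆S : R ∩ S ⊆ S
  R∩S⊆S {R} {S} = subst (_⊆ S) (cong ∁ (∪-comm (∁ S) (∁ R))) R∩S⊆R

  ∁[∁R∪S]⊆R : ∁ (∁ R ∪ S) ⊆ R
  ∁[∁R∪S]⊆R {R} {S} = subst (∁ (∁ R ∪ S) ⊆_) (sym (huntington R S)) S⊆R∪S

  R≡R∩∁R∪∁∁R : ∀ R → R ≡ R ∩ ∁ R ∪ ∁ (∁ R)
  R≡R∩∁R∪∁∁R R = trans (huntington R (∁ R)) (cong (λ Z → R ∩ ∁ R ∪ ∁ Z) (∪-idem (∁ R)))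

  R∪∁R≡∁∁R∪∁R : ∀ R → R ∪ ∁ R ≡ ∁ (∁ R) ∪ ∁ R
  R∪∁R≡∁∁R∪∁R R = begin
    R ∪ ∁ R                        ≡⟨ cong (_∪ ∁ R) (R≡R∩∁R∪∁∁R R) ⟩
    (R ∩ ∁ R ∪ ∁ (∁ R)) ∪ ∁ R      ≡⟨ cong (_∪ ∁ R) (∪-comm _ _) ⟩
    (∁ (∁ R) ∪ R ∩ ∁ R) ∪ ∁ R      ≡⟨ ∪-assoc _ _ _ ⟩
    ∁ (∁ R) ∪ (R ∩ ∁ R ∪ ∁ R)      ≡⟨ cong (∁ (∁ R) ∪_) R∩S⊆S ⟩
    ∁ (∁ R) ∪ ∁ R                  ∎
    where open ≡-Reasoning

  ∁-involutive : ∀ R → ∁ (∁ R) ≡ R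
  ∁-involutive R = sym (trans (R≡R∩∁R∪∁∁R R) R∩∁R⊆∁∁R)
    where
    R∩∁R⊆∁∁R : R ∩ ∁ R ⊆ ∁ (∁ R)
    R∩∁R⊆∁∁R = ⊆-trans (⊆-reflexive (cong ∁ (R∪∁R≡∁∁R∪∁R (∁ R)))) R∩S⊆R

  ∁-antitone : R ⊆ S → ∁ S ⊆ ∁ R
  ∁-antitone {R} {S} R⊆S = begin
    ∁ S                   ≡⟨ cong ∁ R⊆S ⟨
    ∁ (R ∪ S)             ≡⟨ cong (λ Z → ∁ (Z ∪ S)) (∁-involutive R) ⟨
    ∁ (∁ (∁ R) ∪ S)       ⊆⟨ ∁[∁R∪S]⊆R ⟩
    ∁ R                   ∎
    where open ⊆-Reasoning

  ∩-greatest : P ⊆ R → P ⊆ S → P ⊆ R ∩ S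
  ∩-greatest {P} P⊆R P⊆S = subst (_⊆ _) (∁-involutive P)
    (∁-antitone (∪-least (∁-antitone P⊆R) (∁-antitone P⊆S)))

  R⊆S∪∁S : R ⊆ S ∪ ∁ S
  R⊆S∪∁S {R} {S} = begin
    R                        ≡⟨ huntington R S ⟩
    R ∩ S ∪ ∁ (∁ R ∪ S)      ⊆⟨ ∪-mono R∩S⊆S (∁-antitone S⊆R∪S) ⟩
    S ∪ ∁ S                  ∎
    where open ⊆-Reasoning

  R⊆L : R ⊆ L
  R⊆L = R⊆S∪∁S

  ⊆-∁-absurd : P ⊆ R → P ⊆ ∁ R → P ⊆ S
  ⊆-∁-absurd {S = S} P⊆R P⊆∁R = ⊆-trans (∩-greatest P⊆R P⊆∁R)
    (⊆-trans (∁-antitone R⊆S∪∁S) (⊆-reflexive (∁-involutive S)))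

  ⨾-monoˡ : R ⊆ S → R ⨾ T ⊆ S ⨾ T
  ⨾-monoˡ {R} {S} {T} R⊆S = trans (sym (⨾-distribʳ R S T)) (cong (_⨾ T) R⊆S)

  ⨾-monoʳ : R ⊆ S → T ⨾ R ⊆ T ⨾ S
  ⨾-monoʳ {R} {S} {T} R⊆S = trans (sym (⨾-distribˡ T R S)) (cong (T ⨾_) R⊆S)

  ⨾-mono : P ⊆ R → Q ⊆ S → P ⨾ Q ⊆ R ⨾ S
  ⨾-mono P⊆R Q⊆S = ⊆-trans (⨾-monoˡ P⊆R) (⨾-monoʳ Q⊆S)

  schröder-⊆ : R ⨾ S ⊆ ∁ T → R ᵀ ⨾ T ⊆ ∁ S
  schröder-⊆ {R} {S} {T} R⨾S⊆∁T = begin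
    R ᵀ ⨾ T               ≡⟨ cong (R ᵀ ⨾_) (∁-involutive T) ⟨
    R ᵀ ⨾ ∁ (∁ T)         ⊆⟨ ⨾-monoʳ (∁-antitone R⨾S⊆∁T) ⟩
    R ᵀ ⨾ ∁ (R ⨾ S)       ⊆⟨ schröder R S ⟩
    ∁ S                   ∎
    where open ⊆-Reasoning

  -- The part V of R outside W is empty: R ᵀ ⨾ V lies in R ᵀ ⨾ R and, by Schröder, in
  -- ∁ (R ᵀ ⨾ R); so R ᵀ ⨾ V ⊆ ∁ I, which Schröder turns into R ⊆ ∁ V.
  R⊆R⨾Rᵀ⨾R : R ⊆ R ⨾ R ᵀ ⨾ R
  R⊆R⨾Rᵀ⨾R {R} = begin
    R              ≡⟨ huntington R W ⟩
    R ∩ W ∪ V      ⊆⟨ ∪-least R∩S⊆S V⊆W ⟩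
    W              ∎
    where
    open ⊆-Reasoning
    W V : B
    W = R ⨾ R ᵀ ⨾ R
    V = ∁ (∁ R ∪ W)
    V⊆R : V ⊆ R
    V⊆R = ∁[∁R∪S]⊆R
    Rᵀ⨾V⊆∁[Rᵀ⨾R] : R ᵀ ⨾ V ⊆ ∁ (R ᵀ ⨾ R)
    Rᵀ⨾V⊆∁[Rᵀ⨾R] = begin
      R ᵀ ⨾ V                    ⊆⟨ ⨾-monoʳ (∁-antitone S⊆R∪S) ⟩
      R ᵀ ⨾ ∁ W                  ≡⟨ cong (λ Z → R ᵀ ⨾ ∁ Z) (⨾-assoc R (R ᵀ) R) ⟩
      R ᵀ ⨾ ∁ (R ⨾ (R ᵀ ⨾ R))    ⊆⟨ schröder R (R ᵀ ⨾ R) ⟩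
      ∁ (R ᵀ ⨾ R)                ∎
    R⊆∁V : R ⊆ ∁ V
    R⊆∁V = begin
      R              ≡⟨ ᵀ-involutive R ⟨
      (R ᵀ) ᵀ        ≡⟨ ⨾-identityʳ _ ⟨
      (R ᵀ) ᵀ ⨾ I    ⊆⟨ schröder-⊆ (⊆-∁-absurd (⨾-monoʳ V⊆R) Rᵀ⨾V⊆∁[Rᵀ⨾R]) ⟩
      ∁ V            ∎
    V⊆W : V ⊆ W
    V⊆W = ⊆-∁-absurd ⊆-refl (⊆-trans V⊆R R⊆∁V)

  L⨾R⊆L⨾Rᵀ⨾R : L ⨾ R ⊆ L ⨾ R ᵀ ⨾ R
  L⨾R⊆L⨾Rᵀ⨾R {R} = begin
    L ⨾ R                  ⊆⟨ ⨾-monoʳ R⊆R⨾Rᵀ⨾R ⟩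
    L ⨾ (R ⨾ R ᵀ ⨾ R)      ≡⟨ ⨾-assoc L (R ⨾ R ᵀ) R ⟨
    L ⨾ (R ⨾ R ᵀ) ⨾ R      ≡⟨ cong (_⨾ R) (⨾-assoc L R (R ᵀ)) ⟨
    L ⨾ R ⨾ R ᵀ ⨾ R        ⊆⟨ ⨾-monoˡ (⨾-monoˡ R⊆L) ⟩
    L ⨾ R ᵀ ⨾ R            ∎
    where open ⊆-Reasoning

  R⨾L⊆R⨾Rᵀ⨾L : R ⨾ L ⊆ R ⨾ (R ᵀ ⨾ L)
  R⨾L⊆R⨾Rᵀ⨾L {R} = begin
    R ⨾ L                  ⊆⟨ ⨾-monoˡ R⊆R⨾Rᵀ⨾R ⟩
    R ⨾ R ᵀ ⨾ R ⨾ L        ≡⟨ ⨾-assoc (R ⨾ R ᵀ) R L ⟩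
    R ⨾ R ᵀ ⨾ (R ⨾ L)      ≡⟨ ⨾-assoc R (R ᵀ) (R ⨾ L) ⟩
    R ⨾ (R ᵀ ⨾ (R ⨾ L))    ⊆⟨ ⨾-monoʳ (⨾-monoʳ R⊆L) ⟩
    R ⨾ (R ᵀ ⨾ L)          ∎
    where open ⊆-Reasoning

  I⊆R* : I ⊆ R *
  I⊆R* {R} = ⊆-trans R⊆R∪S (star-unfoldˡ R)

  R⨾R*⊆R* : R ⨾ R * ⊆ R *
  R⨾R*⊆R* {R} = ⊆-trans S⊆R∪S (star-unfoldˡ R)

  R*⨾R⊆R* : R * ⨾ R ⊆ R *
  R*⨾R⊆R* {R} = ⊆-trans S⊆R∪S (star-unfoldʳ R)

  R⊆R⁺ : R ⊆ R ⁺
  R⊆R⁺ {R} = subst (_⊆ R ⁺) (⨾-identityʳ R) (⨾-monoʳ I⊆R*)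

  R⊆R* : R ⊆ R *
  R⊆R* = ⊆-trans R⊆R⁺ R⨾R*⊆R*

  R*⊆I∪R*⨾R : R * ⊆ I ∪ R * ⨾ R
  R*⊆I∪R*⨾R {R} = subst (_⊆ I ∪ R * ⨾ R) (⨾-identityˡ (R *))
    (star-inductʳ R I (I ∪ R * ⨾ R) (∪-least R⊆R∪S closed))
    where
    open ⊆-Reasoning
    closed : (I ∪ R * ⨾ R) ⨾ R ⊆ I ∪ R * ⨾ R
    closed = begin
      (I ∪ R * ⨾ R) ⨾ R        ≡⟨ ⨾-distribʳ I (R * ⨾ R) R ⟩
      I ⨾ R ∪ R * ⨾ R ⨾ R      ≡⟨ cong (_∪ R * ⨾ R ⨾ R) (⨾-identityˡ R) ⟩
      R ∪ R * ⨾ R ⨾ R          ⊆⟨ ∪-least (subst (_⊆ R * ⨾ R) (⨾-identityˡ R) (⨾-monoˡ I⊆R*))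
                                          (⨾-monoˡ R*⨾R⊆R*) ⟩
      R * ⨾ R                  ⊆⟨ S⊆R∪S ⟩
      I ∪ R * ⨾ R              ∎

  R*⊆I∪R⨾R* : R * ⊆ I ∪ R ⨾ R *
  R*⊆I∪R⨾R* {R} = subst (_⊆ I ∪ R ⨾ R *) (⨾-identityʳ (R *))
    (star-inductˡ R I (I ∪ R ⨾ R *) (∪-least R⊆R∪S closed))
    where
    open ⊆-Reasoning
    closed : R ⨾ (I ∪ R ⨾ R *) ⊆ I ∪ R ⨾ R *
    closed = begin
      R ⨾ (I ∪ R ⨾ R *)          ≡⟨ ⨾-distribˡ R I (R ⨾ R *) ⟩
      R ⨾ I ∪ R ⨾ (R ⨾ R *)      ≡⟨ cong (_∪ R ⨾ (R ⨾ R *)) (⨾-identityʳ R) ⟩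
      R ∪ R ⨾ (R ⨾ R *)          ⊆⟨ ∪-least R⊆R⁺ (⨾-monoʳ R⨾R*⊆R*) ⟩
      R ⨾ R *                    ⊆⟨ S⊆R∪S ⟩
      I ∪ R ⨾ R *                ∎

  R*⨾S⊆S∪R* : R ⨾ S ⊆ I → R * ⨾ S ⊆ S ∪ R *
  R*⨾S⊆S∪R* {R} {S} R⨾S⊆I = begin
    R * ⨾ S                     ⊆⟨ ⨾-monoˡ R*⊆I∪R*⨾R ⟩
    (I ∪ R * ⨾ R) ⨾ S           ≡⟨ ⨾-distribʳ I (R * ⨾ R) S ⟩
    I ⨾ S ∪ R * ⨾ R ⨾ S         ≡⟨ cong₂ _∪_ (⨾-identityˡ S) (⨾-assoc (R *) R S) ⟩
    S ∪ R * ⨾ (R ⨾ S)           ⊆⟨ ∪-mono ⊆-refl (⨾-monoʳ R⨾S⊆I) ⟩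
    S ∪ R * ⨾ I                 ≡⟨ cong (S ∪_) (⨾-identityʳ (R *)) ⟩
    S ∪ R *                     ∎
    where open ⊆-Reasoning

  S⨾R*⊆S∪R* : S ⨾ R ⊆ I → S ⨾ R * ⊆ S ∪ R *
  S⨾R*⊆S∪R* {S} {R} S⨾R⊆I = begin
    S ⨾ R *                     ⊆⟨ ⨾-monoʳ R*⊆I∪R⨾R* ⟩
    S ⨾ (I ∪ R ⨾ R *)           ≡⟨ ⨾-distribˡ S I (R ⨾ R *) ⟩
    S ⨾ I ∪ S ⨾ (R ⨾ R *)       ≡⟨ cong₂ _∪_ (⨾-identityʳ S) (sym (⨾-assoc S R (R *))) ⟩
    S ∪ S ⨾ R ⨾ R *             ⊆⟨ ∪-mono ⊆-refl (⨾-monoˡ S⨾R⊆I) ⟩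
    S ∪ I ⨾ R *                 ≡⟨ cong (S ∪_) (⨾-identityˡ (R *)) ⟩
    S ∪ R *                     ∎
    where open ⊆-Reasoning

  R*∪S*-closedʳ : S ⨾ R ⊆ I → (R * ∪ S *) ⨾ R ⊆ R * ∪ S *
  R*∪S*-closedʳ {S} {R} S⨾R⊆I = begin
    (R * ∪ S *) ⨾ R          ≡⟨ ⨾-distribʳ (R *) (S *) R ⟩
    R * ⨾ R ∪ S * ⨾ R        ⊆⟨ ∪-mono R*⨾R⊆R* (R*⨾S⊆S∪R* S⨾R⊆I) ⟩
    R * ∪ (R ∪ S *)          ⊆⟨ ∪-least R⊆R∪S (∪-mono R⊆R* ⊆-refl) ⟩
    R * ∪ S *                ∎
    where open ⊆-Reasoning

  R*∪S*-closedˡ : R ⨾ S ⊆ I → R ⨾ (R * ∪ S *) ⊆ R * ∪ S *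
  R*∪S*-closedˡ {R} {S} R⨾S⊆I = begin
    R ⨾ (R * ∪ S *)          ≡⟨ ⨾-distribˡ R (R *) (S *) ⟩
    R ⨾ R * ∪ R ⨾ S *        ⊆⟨ ∪-mono R⨾R*⊆R* (S⨾R*⊆S∪R* R⨾S⊆I) ⟩
    R * ∪ (R ∪ S *)          ⊆⟨ ∪-least R⊆R∪S (∪-mono R⊆R* ⊆-refl) ⟩
    R * ∪ S *                ∎
    where open ⊆-Reasoning

  flipʳ : T ⨾ R ⊆ T → X ⨾ L ⨾ R ᵀ ⊆ T → X ⨾ L ⨾ R ⊆ T
  flipʳ {T} {R} {X} T⨾R⊆T X⨾L⨾Rᵀ⊆T = begin
    X ⨾ L ⨾ R                ≡⟨ ⨾-assoc X L R ⟩
    X ⨾ (L ⨾ R)              ⊆⟨ ⨾-monoʳ L⨾R⊆L⨾Rᵀ⨾R ⟩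
    X ⨾ (L ⨾ R ᵀ ⨾ R)        ≡⟨ ⨾-assoc X (L ⨾ R ᵀ) R ⟨
    X ⨾ (L ⨾ R ᵀ) ⨾ R        ≡⟨ cong (_⨾ R) (⨾-assoc X L (R ᵀ)) ⟨
    X ⨾ L ⨾ R ᵀ ⨾ R          ⊆⟨ ⨾-monoˡ X⨾L⨾Rᵀ⊆T ⟩
    T ⨾ R                    ⊆⟨ T⨾R⊆T ⟩
    T                        ∎
    where open ⊆-Reasoning

  flipˡ : R ⨾ T ⊆ T → R ᵀ ⨾ L ⨾ Y ⊆ T → R ⨾ L ⨾ Y ⊆ T
  flipˡ {R} {T} {Y} R⨾T⊆T Rᵀ⨾L⨾Y⊆T = begin
    R ⨾ L ⨾ Y                ⊆⟨ ⨾-monoˡ R⨾L⊆R⨾Rᵀ⨾L ⟩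
    R ⨾ (R ᵀ ⨾ L) ⨾ Y        ≡⟨ ⨾-assoc R (R ᵀ ⨾ L) Y ⟩
    R ⨾ (R ᵀ ⨾ L ⨾ Y)        ⊆⟨ ⨾-monoʳ Rᵀ⨾L⨾Y⊆T ⟩
    R ⨾ T                    ⊆⟨ R⨾T⊆T ⟩
    T                        ∎
    where open ⊆-Reasoning

  flipᵀʳ : T ⨾ R ᵀ ⊆ T → X ⨾ L ⨾ R ⊆ T → X ⨾ L ⨾ R ᵀ ⊆ T
  flipᵀʳ {T} {R} {X} T⨾Rᵀ⊆T =
    flipʳ T⨾Rᵀ⊆T ∘ subst (λ Z → X ⨾ L ⨾ Z ⊆ T) (sym (ᵀ-involutive R))

  flipᵀˡ : R ᵀ ⨾ T ⊆ T → R ⨾ L ⨾ Y ⊆ T → R ᵀ ⨾ L ⨾ Y ⊆ T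
  flipᵀˡ {R} {T} {Y} Rᵀ⨾T⊆T =
    flipˡ Rᵀ⨾T⊆T ∘ subst (λ Z → Z ⨾ L ⨾ Y ⊆ T) (sym (ᵀ-involutive R))

  X⨾L⨾Y⊆X⁺⨾L⨾Y⁺ : X ⨾ L ⨾ Y ⊆ X ⁺ ⨾ L ⨾ Y ⁺
  X⨾L⨾Y⊆X⁺⨾L⨾Y⁺ = ⨾-mono (⨾-monoˡ R⊆R⁺) R⊆R⁺

  X⁺⨾L⨾Y⁺⊆X⨾L⨾Y : X ⁺ ⨾ L ⨾ Y ⁺ ⊆ X ⨾ L ⨾ Y
  X⁺⨾L⨾Y⁺⊆X⨾L⨾Y {X} {Y} = begin
    X ⁺ ⨾ L ⨾ Y ⁺            ≡⟨ cong (_⨾ Y ⁺) (⨾-assoc X (X *) L) ⟩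
    X ⨾ (X * ⨾ L) ⨾ Y ⁺      ⊆⟨ ⨾-monoˡ (⨾-monoʳ R⊆L) ⟩
    X ⨾ L ⨾ Y ⁺              ≡⟨ ⨾-assoc X L (Y ⁺) ⟩
    X ⨾ (L ⨾ (Y ⨾ Y *))      ≡⟨ cong (X ⨾_) (⨾-assoc L Y (Y *)) ⟨
    X ⨾ (L ⨾ Y ⨾ Y *)        ⊆⟨ ⨾-monoʳ L⨾Y⨾Y*⊆L⨾Y ⟩
    X ⨾ (L ⨾ Y)              ≡⟨ ⨾-assoc X L Y ⟨
    X ⨾ L ⨾ Y                ∎
    where
    open ⊆-Reasoning
    L⨾Y⨾Y*⊆L⨾Y : L ⨾ Y ⨾ Y * ⊆ L ⨾ Y
    L⨾Y⨾Y*⊆L⨾Y = star-inductʳ Y (L ⨾ Y) (L ⨾ Y) (∪-least ⊆-refl (⨾-monoˡ R⊆L))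

  comparable : B → B
  comparable R = R * ∪ (R ᵀ) *

  module EightProperties (R : B) (univalent : Univalent R) (injective : Injective R) where

    comparable⨾R⊆comparable : comparable R ⨾ R ⊆ comparable R
    comparable⨾R⊆comparable = R*∪S*-closedʳ univalent

    comparable⨾Rᵀ⊆comparable : comparable R ⨾ R ᵀ ⊆ comparable R
    comparable⨾Rᵀ⊆comparable =
      subst (λ Z → Z ⨾ R ᵀ ⊆ Z) (∪-comm ((R ᵀ) *) (R *)) (R*∪S*-closedʳ injective)

    R⨾comparable⊆comparable : R ⨾ comparable R ⊆ comparable R
    R⨾comparable⊆comparable = R*∪S*-closedˡ injective

    Rᵀ⨾comparable⊆comparable : R ᵀ ⨾ comparable R ⊆ comparable R
    Rᵀ⨾comparable⊆comparable =
      subst (λ Z → R ᵀ ⨾ Z ⊆ Z) (∪-comm ((R ᵀ) *) (R *)) (R*∪S*-closedˡ univalent)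

    Property⇒Property₀ : ∀ i → Property R i → Property R zero
    Property⇒Property₀ zero = id
    Property⇒Property₀ (suc zero) = flipʳ comparable⨾R⊆comparable
    Property⇒Property₀ (suc (suc zero)) = flipˡ R⨾comparable⊆comparable
    Property⇒Property₀ (suc (suc (suc zero))) =
      flipˡ R⨾comparable⊆comparable ∘ flipʳ comparable⨾R⊆comparable
    Property⇒Property₀ (suc (suc (suc (suc zero)))) = ⊆-trans X⨾L⨾Y⊆X⁺⨾L⨾Y⁺
    Property⇒Property₀ (suc (suc (suc (suc (suc zero))))) =
      flipʳ comparable⨾R⊆comparable ∘ ⊆-trans X⨾L⨾Y⊆X⁺⨾L⨾Y⁺
    Property⇒Property₀ (suc (suc (suc (suc (suc (suc zero)))))) =
      flipˡ R⨾comparable⊆comparable ∘ ⊆-trans X⨾L⨾Y⊆X⁺⨾L⨾Y⁺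
    Property⇒Property₀ (suc (suc (suc (suc (suc (suc (suc zero))))))) =
      flipˡ R⨾comparable⊆comparable ∘ flipʳ comparable⨾R⊆comparable ∘ ⊆-trans X⨾L⨾Y⊆X⁺⨾L⨾Y⁺

    Property₀⇒Property : ∀ i → Property R zero → Property R i
    Property₀⇒Property zero = id
    Property₀⇒Property (suc zero) = flipᵀʳ comparable⨾Rᵀ⊆comparable
    Property₀⇒Property (suc (suc zero)) = flipᵀˡ Rᵀ⨾comparable⊆comparable
    Property₀⇒Property (suc (suc (suc zero))) =
      flipᵀˡ Rᵀ⨾comparable⊆comparable ∘ flipᵀʳ comparable⨾Rᵀ⊆comparable
    Property₀⇒Property (suc (suc (suc (suc zero)))) = ⊆-trans X⁺⨾L⨾Y⁺⊆X⨾L⨾Y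
    Property₀⇒Property (suc (suc (suc (suc (suc zero))))) =
      ⊆-trans X⁺⨾L⨾Y⁺⊆X⨾L⨾Y ∘ flipᵀʳ comparable⨾Rᵀ⊆comparable
    Property₀⇒Property (suc (suc (suc (suc (suc (suc zero)))))) =
      ⊆-trans X⁺⨾L⨾Y⁺⊆X⨾L⨾Y ∘ flipᵀˡ Rᵀ⨾comparable⊆comparable
    Property₀⇒Property (suc (suc (suc (suc (suc (suc (suc zero))))))) =
      ⊆-trans X⁺⨾L⨾Y⁺⊆X⨾L⨾Y ∘ flipᵀˡ Rᵀ⨾comparable⊆comparable ∘ flipᵀʳ comparable⨾Rᵀ⊆comparable

mainTheorem2 : {c : Level} (K : KleeneRelationAlgebra c) →
    let open KleeneRelationAlgebra K in
    (R : B) → Univalent R → Injective R →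
    (i j : Fin 8) → Property R i → Property R j
mainTheorem2 K R univalent injective i j = Property₀⇒Property j ∘ Property⇒Property₀ i
  where open KleeneRelationAlgebraProperties.EightProperties K R univalent injective
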